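{- Let $G\in\mathcal{G}$, with cliques on $X=\{x_1,\ldots,x_m\}$ and $Y=\{y_1,\ldots,y_n\}$, where $n>m$ and both $n$ and $m$ are odd, such that $N[x_1]=\{y_1,\ldots,y_s\}\cup X$, $N[x_2]=\{y_{s+1},\ldots,y_{s+t}\}\cup X$, and $N[x_i]=X$ for all $3\leq i\leq m$, where $s,t\ge 0$ and $0\leq s+t\leq n-m$. Then $T_2(G)$ is well-covered.
   Context: $\mathcal{G}$ is the class of graphs obtained by taking the disjoint union of a complete graph $K_m$ with vertex set $X=\{x_1,\ldots,x_m\}$ and a complete graph $K_n$ with vertex set $Y=\{y_1,\ldots,y_n\}$, where $n\geq m$, and then adding some (possibly no) edges each joining a vertex of $X$ to a vertex of $Y$. $N[v]$ denotes the closed neighbourhood of $v$ ($v$ together with all its neighbours). The $2$-token graph $T_2(G)$ has as vertices the $2$-subsets of $V(G)$, two of them adjacent if their symmetric difference is an edge of $G$. A graph is well-covered if all of its maximal (with respect to inclusion) independent sets have the same cardinality. -}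

module Defs where

open import Data.Nat using (ℕ; zero; suc; _+_; _≤_; _<_)
open import Data.Fin using (Fin; toℕ; splitAt)
import Data.Fin as F
open import Data.Sum using (_⊎_; inj₁; inj₂)
open import Data.Product using (Σ; _×_; _,_; ∃; ∃-syntax; proj₁; proj₂)
open import Data.List using (List; length)
open import Data.List.Membership.Propositional using (_∈_)
open import Data.List.Relation.Unary.Unique.Propositional using (Unique)
open import Relation.Binary.PropositionalEquality using (_≡_; _≢_)
open import Relation.Nullary using (¬_)
open import Data.Unit using (⊤)
open import Data.Empty using (⊥)
open import Function.Bundles using (_⇔_)

record Graph (N : ℕ) : Set₁ where
  field
    Adj : Fin N → Fin N → Set

open Graph public

-- A set of vertices is represented by a duplicate-free list; its
-- cardinality is the length of the list.
Independent : {V : Set} → (V → V → Set) → List V → Set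
Independent A S = ∀ {u v} → u ∈ S → v ∈ S → ¬ A u v

MaximalIndependent : {V : Set} → (V → V → Set) → List V → Set
MaximalIndependent {V} A S =
  Unique S × Independent A S ×
  (∀ (S' : List V) → Independent A S' → (∀ {v} → v ∈ S → v ∈ S') →
     ∀ {v} → v ∈ S' → v ∈ S)

WellCovered : {V : Set} → (V → V → Set) → Set
WellCovered {V} A =
  ∀ (S S' : List V) → MaximalIndependent A S → MaximalIndependent A S' →
    length S ≡ length S'

TwoSet : ℕ → Set
TwoSet N = Σ (Fin N × Fin N) (λ p → proj₁ p F.< proj₂ p)

_∈₂_ : ∀ {N} → Fin N → TwoSet N → Set
w ∈₂ ((a , b) , _) = (w ≡ a) ⊎ (w ≡ b)

-- Two 2-subsets are adjacent iff their symmetric difference is an edge.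
T₂Adj : ∀ {N} → Graph N → TwoSet N → TwoSet N → Set
T₂Adj {N} G A B =
  ∃[ u ] ∃[ v ] (Adj G u v ×
    (∀ (w : Fin N) →
       (((w ∈₂ A) × ¬ (w ∈₂ B)) ⊎ ((w ∈₂ B) × ¬ (w ∈₂ A))) ⇔ ((w ≡ u) ⊎ (w ≡ v))))

-- The specific graph of Theorem 6.10.
-- Vertices: Fin (m + n); x_{i+1} = i ↑ˡ n (i : Fin m), y_{j+1} = m ↑ʳ j (j : Fin n)
-- (0-based indices). X and Y are cliques; the only X–Y edges are
-- x_1 y_j for 1 ≤ j ≤ s and x_2 y_j for s+1 ≤ j ≤ s+t.

Cross : (s t : ℕ) → ∀ {m n} → Fin m → Fin n → Set
Cross s t i j = ((toℕ i ≡ 0) × (toℕ j < s)) ⊎ ((toℕ i ≡ 1) × (s ≤ toℕ j) × (toℕ j < s + t))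

AdjG : (m n s t : ℕ) → Fin (m + n) → Fin (m + n) → Set
AdjG m n s t u v with splitAt m u | splitAt m v
... | inj₁ i | inj₁ i' = i ≢ i'
... | inj₂ j | inj₂ j' = j ≢ j'
... | inj₁ i | inj₂ j  = Cross s t i j
... | inj₂ j | inj₁ i  = Cross s t i j

Gmnst : (m n s t : ℕ) → Graph (m + n)
Gmnst m n s t = record { Adj = AdjG m n s t }

-- Let S be a maximal independent set of T₂(G) and sort its 2-sets by kind XX, XY and YY.
-- Two 2-sets of S of the same kind sharing a vertex would be adjacent in T₂(G), because their
-- other members lie in a common clique; so each kind is a matching.  By maximality every 2-set
-- outside S is one token slide away from S.  For two vertices of X missed by the XX-matching
-- this means that the XY-partner of one is adjacent to the other; as every y has at most one
-- neighbour in X and only x₁, x₂ have neighbours in Y, no three such vertices exist, and since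
-- |X| is odd exactly one vertex of X is missed.  The same holds for Y.  A vertex x missed by
-- the XY-matching would give, for each y, a distinct reason why {x, y} ∉ S, i.e. n + 1 distinct
-- elements of X ⊎ {y₁, …, y_{s+t}}, contradicting s + t ≤ n − m.  Hence every maximal
-- independent set has (m − 1)/2 + m + (n − 1)/2 elements.

module Submission where

open import Defs
open import Data.Nat using (ℕ; zero; suc; _+_; _*_; _∸_; _≤_; _<_; _%_; z≤n; s≤s)
import Data.Nat.Properties as ℕP
import Data.Nat.DivMod as DivMod
open import Data.Fin as F using (Fin; toℕ; _↑ˡ_; _↑ʳ_; splitAt; join)
import Data.Fin.Properties as FP
open import Data.Fin.Properties using (_≟_)
open import Data.Sum using (_⊎_; inj₁; inj₂; [_,_]′; swap)
import Data.Sum as Sum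
import Data.Sum.Properties as SumP
open import Data.Product using (_×_; _,_; ∃-syntax; proj₁; proj₂)
open import Data.List using (List; []; _∷_; length; filter)
open import Data.List.Membership.Propositional using (_∈_; _∉_)
open import Data.List.Relation.Unary.Any using (here; there)
open import Data.List.Relation.Unary.All as All using (All; []; _∷_)
open import Data.List.Relation.Unary.All.Properties using (all-filter)
import Data.List.Relation.Unary.Unique.Propositional.Properties as Unique
open import Data.List.Membership.Propositional.Properties using (∈-filter⁺; ∈-filter⁻)
open import Data.List.Relation.Unary.AllPairs using (_∷_)
open import Data.List.Relation.Unary.Unique.Propositional using (Unique)
open import Data.Empty using (⊥; ⊥-elim)
open import Relation.Nullary using (¬_; Dec; yes; no)
open import Relation.Nullary.Negation using (¬¬-map)
open import Relation.Unary using (Decidable)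
open import Relation.Nullary.Decidable using (_⊎-dec_)
open import Relation.Binary using (tri<; tri≈; tri>)
open import Relation.Binary.PropositionalEquality
open import Function using (_∘_)
open import Algebra.Properties.CommutativeMonoid.Sum ℕP.+-0-commutativeMonoid
  using (sum-syntax; ∑-distrib-+; sum-cong-≗; sum-replicate-zero)
open import Function.Bundles using (mk⇔; Equivalence)

private variable
  N : ℕ
  u v w : Fin N
  p q A B : TwoSet N

-- 2-subsets

fst snd : TwoSet N → Fin N
fst ((a , _) , _) = a
snd ((_ , b) , _) = b

fst≢snd : (p : TwoSet N) → fst p ≢ snd p
fst≢snd (_ , a<b) = FP.<⇒≢ a<b

_∈₂?_ : (x : Fin N) (p : TwoSet N) → Dec (x ∈₂ p)
x ∈₂? ((a , b) , _) = x ≟ a ⊎-dec x ≟ b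

∈₂-cases : (p : TwoSet N) → u ∈₂ p → v ∈₂ p → u ≢ v → w ∈₂ p → w ≡ u ⊎ w ≡ v
∈₂-cases _ (inj₁ refl) (inj₁ refl) u≢v _           = ⊥-elim (u≢v refl)
∈₂-cases _ (inj₂ refl) (inj₂ refl) u≢v _           = ⊥-elim (u≢v refl)
∈₂-cases _ (inj₁ refl) (inj₂ refl) _   (inj₁ refl) = inj₁ refl
∈₂-cases _ (inj₁ refl) (inj₂ refl) _   (inj₂ refl) = inj₂ refl
∈₂-cases _ (inj₂ refl) (inj₁ refl) _   (inj₁ refl) = inj₂ refl
∈₂-cases _ (inj₂ refl) (inj₁ refl) _   (inj₂ refl) = inj₁ refl

other : (p : TwoSet N) → w ∈₂ p → Fin N
other p (inj₁ _) = snd p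
other p (inj₂ _) = fst p

other-∈₂ : (w∈p : w ∈₂ p) → other p w∈p ∈₂ p
other-∈₂ (inj₁ _) = inj₂ refl
other-∈₂ (inj₂ _) = inj₁ refl

other-≢ : (w∈p : w ∈₂ p) → other p w∈p ≢ w
other-≢ {p = p} (inj₁ refl) = fst≢snd p ∘ sym
other-≢ {p = p} (inj₂ refl) = fst≢snd p

≡-by-members : u ≢ v → u ∈₂ p → v ∈₂ p → u ∈₂ q → v ∈₂ q → p ≡ q
≡-by-members {p = p} {q = q} u≢v u∈p v∈p u∈q v∈q = ⊆-≡ p q (into (inj₁ refl)) (into (inj₂ refl))
  where
  into : w ∈₂ p → w ∈₂ q
  into w∈p with ∈₂-cases p u∈p v∈p u≢v w∈p
  ... | inj₁ refl = u∈q
  ... | inj₂ refl = v∈q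
  ⊆-≡ : (p q : TwoSet N) → fst p ∈₂ q → snd p ∈₂ q → p ≡ q
  ⊆-≡ (_ , a<b) (_ , a<b′) (inj₁ refl) (inj₂ refl) = cong (_ ,_) (FP.<-irrelevant a<b a<b′)
  ⊆-≡ (_ , a<b) _          (inj₁ refl) (inj₁ refl) = ⊥-elim (FP.<⇒≢ a<b refl)
  ⊆-≡ (_ , a<b) _          (inj₂ refl) (inj₂ refl) = ⊥-elim (FP.<⇒≢ a<b refl)
  ⊆-≡ (_ , a<b) (_ , b<a)  (inj₂ refl) (inj₁ refl) = ⊥-elim (FP.<-asym a<b b<a)

pair : (a b : Fin N) → a ≢ b → TwoSet N
pair a b a≢b with FP.<-cmp a b
... | tri< a<b _ _ = (a , b) , a<b
... | tri≈ _ a≡b _ = ⊥-elim (a≢b a≡b)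
... | tri> _ _ b<a = (b , a) , b<a

∈-pairˡ : (a≢b : u ≢ v) → u ∈₂ pair u v a≢b
∈-pairˡ {u = a} {v = b} a≢b with FP.<-cmp a b
... | tri< _ _ _   = inj₁ refl
... | tri≈ _ a≡b _ = ⊥-elim (a≢b a≡b)
... | tri> _ _ _   = inj₂ refl

∈-pairʳ : (a≢b : u ≢ v) → v ∈₂ pair u v a≢b
∈-pairʳ {u = a} {v = b} a≢b with FP.<-cmp a b
... | tri< _ _ _   = inj₂ refl
... | tri≈ _ a≡b _ = ⊥-elim (a≢b a≡b)
... | tri> _ _ _   = inj₁ refl

-- Token graphs

module TokenGraph (G : Graph N) (adj-irrefl : ∀ {u} → ¬ Adj G u u)
                  (adj-sym : ∀ {u v} → Adj G u v → Adj G v u) where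

  record Slide (A B : TwoSet N) : Set where
    field
      stay src dst : Fin N
      stay∈A   : stay ∈₂ A
      stay∈B   : stay ∈₂ B
      src∈A    : src ∈₂ A
      src≢stay : src ≢ stay
      dst∈B    : dst ∈₂ B
      dst∉A    : ¬ dst ∈₂ A
      edge     : Adj G src dst

    dst≢stay : dst ≢ stay
    dst≢stay dst≡stay = dst∉A (subst (_∈₂ A) (sym dst≡stay) stay∈A)

    src∉B : ¬ src ∈₂ B
    src∉B src∈B with ∈₂-cases B stay∈B dst∈B (dst≢stay ∘ sym) src∈B
    ... | inj₁ src≡stay = src≢stay src≡stay
    ... | inj₂ src≡dst  = dst∉A (subst (_∈₂ A) src≡dst src∈A)

  slide-sym : Slide A B → Slide B A
  slide-sym s = record
    { stay = stay ; src = dst ; dst = src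
    ; stay∈A = stay∈B ; stay∈B = stay∈A ; src∈A = dst∈B ; src≢stay = dst≢stay
    ; dst∈B = src∈A ; dst∉A = src∉B ; edge = adj-sym edge }
    where open Slide s

  slide⇒T₂Adj : Slide A B → T₂Adj G A B
  slide⇒T₂Adj {A = A} {B = B} s = src , dst , edge , λ x → mk⇔ (to x) from
    where
    open Slide s
    to : ∀ x → (x ∈₂ A × ¬ x ∈₂ B) ⊎ (x ∈₂ B × ¬ x ∈₂ A) → x ≡ src ⊎ x ≡ dst
    to x (inj₁ (x∈A , x∉B)) with ∈₂-cases A stay∈A src∈A (src≢stay ∘ sym) x∈A
    ... | inj₁ refl = ⊥-elim (x∉B stay∈B)
    ... | inj₂ refl = inj₁ refl
    to x (inj₂ (x∈B , x∉A)) with ∈₂-cases B stay∈B dst∈B (dst≢stay ∘ sym) x∈B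
    ... | inj₁ refl = ⊥-elim (x∉A stay∈A)
    ... | inj₂ refl = inj₂ refl
    from : ∀ {x} → x ≡ src ⊎ x ≡ dst → (x ∈₂ A × ¬ x ∈₂ B) ⊎ (x ∈₂ B × ¬ x ∈₂ A)
    from (inj₁ refl) = inj₁ (src∈A , src∉B)
    from (inj₂ refl) = inj₂ (dst∈B , dst∉A)

  private
    slide-across : ∀ {A B : TwoSet N} {u v} → u ∈₂ A → v ∈₂ B → ¬ v ∈₂ A →
                   (∀ {x} → x ∈₂ A → ¬ x ∈₂ B → x ≡ u ⊎ x ≡ v) → Adj G u v → Slide A B
    slide-across {A} {B} {u} {v} u∈A v∈B v∉A A∖B⊆uv u~v with other A u∈A ∈₂? B
    ... | yes o∈B = record
      { stay = other A u∈A ; src = u ; dst = v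
      ; stay∈A = other-∈₂ u∈A ; stay∈B = o∈B ; src∈A = u∈A ; src≢stay = other-≢ u∈A ∘ sym
      ; dst∈B = v∈B ; dst∉A = v∉A ; edge = u~v }
    ... | no o∉B with A∖B⊆uv (other-∈₂ u∈A) o∉B
    ...   | inj₁ o≡u = ⊥-elim (other-≢ u∈A o≡u)
    ...   | inj₂ o≡v = ⊥-elim (v∉A (subst (_∈₂ A) o≡v (other-∈₂ u∈A)))

    lopsided : ∀ {A B : TwoSet N} {u v} → u ≢ v → u ∈₂ A → ¬ u ∈₂ B → v ∈₂ A → ¬ v ∈₂ B →
               ¬ (∀ {x} → x ∈₂ B → ¬ x ∈₂ A → x ≡ u ⊎ x ≡ v)
    lopsided {A} {B} u≢v u∈A u∉B v∈A v∉B B∖A⊆uv with fst B ∈₂? A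
    ... | yes b∈A = [ (λ { refl → u∉B (inj₁ refl) }) , (λ { refl → v∉B (inj₁ refl) }) ]′
                      (∈₂-cases A u∈A v∈A u≢v b∈A)
    ... | no b∉A = [ (λ { refl → b∉A u∈A }) , (λ { refl → b∉A v∈A }) ]′ (B∖A⊆uv (inj₁ refl) b∉A)

  T₂Adj⇒slide : T₂Adj G A B → Slide A B
  T₂Adj⇒slide {A = A} {B = B} (a , b , a~b , symdiff) =
    classify (Equivalence.from (symdiff a) (inj₁ refl)) (Equivalence.from (symdiff b) (inj₂ refl))
    where
    a≢b : a ≢ b
    a≢b refl = adj-irrefl a~b
    A∖B⊆ab : ∀ {x} → x ∈₂ A → ¬ x ∈₂ B → x ≡ a ⊎ x ≡ b
    A∖B⊆ab x∈A x∉B = Equivalence.to (symdiff _) (inj₁ (x∈A , x∉B))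
    B∖A⊆ab : ∀ {x} → x ∈₂ B → ¬ x ∈₂ A → x ≡ a ⊎ x ≡ b
    B∖A⊆ab x∈B x∉A = Equivalence.to (symdiff _) (inj₂ (x∈B , x∉A))
    classify : (a ∈₂ A × ¬ a ∈₂ B) ⊎ (a ∈₂ B × ¬ a ∈₂ A) →
               (b ∈₂ A × ¬ b ∈₂ B) ⊎ (b ∈₂ B × ¬ b ∈₂ A) → Slide A B
    classify (inj₁ (a∈A , _))   (inj₂ (b∈B , b∉A)) = slide-across a∈A b∈B b∉A A∖B⊆ab a~b
    classify (inj₂ (a∈B , a∉A)) (inj₁ (b∈A , _))   =
      slide-across b∈A a∈B a∉A (λ x∈A x∉B → swap (A∖B⊆ab x∈A x∉B)) (adj-sym a~b)
    classify (inj₁ (a∈A , a∉B)) (inj₁ (b∈A , b∉B)) = ⊥-elim (lopsided {A} {B} a≢b a∈A a∉B b∈A b∉B B∖A⊆ab)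
    classify (inj₂ (a∈B , a∉A)) (inj₂ (b∈B , b∉A)) = ⊥-elim (lopsided {B} {A} a≢b a∈B a∉A b∈B b∉A A∖B⊆ab)

  T₂Adj-irrefl : ¬ T₂Adj G A A
  T₂Adj-irrefl {A = A} adj = dst∉A dst∈B
    where open Slide (T₂Adj⇒slide {A = A} {B = A} adj)

  absorbed : ∀ {S P} → MaximalIndependent (T₂Adj G) S → (∀ {q} → q ∈ S → ¬ Slide P q) → P ∈ S
  absorbed {S} {P} (_ , indep , maximal) no-slide = maximal (P ∷ S) indep′ there (here refl)
    where
    indep′ : Independent (T₂Adj G) (P ∷ S)
    indep′ (here refl) (here refl) = T₂Adj-irrefl {A = P}
    indep′ (here refl) (there q∈S) = no-slide q∈S ∘ T₂Adj⇒slide {A = P}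
    indep′ (there q∈S) (here refl) = no-slide q∈S ∘ slide-sym ∘ T₂Adj⇒slide {B = P}
    indep′ (there p∈S) (there q∈S) = indep p∈S q∈S

  record SlidesInto (S : List (TwoSet N)) (a b : Fin N) : Set where
    field
      target   : TwoSet N
      target∈S : target ∈ S
      a∈target : a ∈₂ target
      moved    : Fin N
      moved∈target : moved ∈₂ target
      moved≢a  : moved ≢ a
      moved≢b  : moved ≢ b
      edge     : Adj G b moved

  slides-into : ∀ {S a b} → MaximalIndependent (T₂Adj G) S → (a≢b : a ≢ b) → pair a b a≢b ∉ S →
                ¬ ¬ (SlidesInto S a b ⊎ SlidesInto S b a)
  slides-into {S} {a} {b} mis a≢b P∉S neither = P∉S (absorbed mis no-slide)
    where
    P = pair a b a≢b
    ∈P : ∀ {x} → x ∈₂ P → x ≡ a ⊎ x ≡ b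
    ∈P = ∈₂-cases P (∈-pairˡ a≢b) (∈-pairʳ a≢b) a≢b
    into : ∀ {q c d} → q ∈ S → (s : Slide P q) → Slide.stay s ≡ c → Slide.src s ≡ d → SlidesInto S c d
    into q∈S s refl refl = record
      { target = _ ; target∈S = q∈S ; a∈target = stay∈B ; moved = dst ; moved∈target = dst∈B
      ; moved≢a = dst≢stay ; moved≢b = λ e → dst∉A (subst (_∈₂ P) (sym e) src∈A) ; edge = edge }
      where open Slide s
    no-slide : ∀ {q} → q ∈ S → ¬ Slide P q
    no-slide q∈S s with ∈P (Slide.stay∈A s) | ∈P (Slide.src∈A s)
    ... | inj₁ e | inj₁ e′ = Slide.src≢stay s (trans e′ (sym e))
    ... | inj₂ e | inj₂ e′ = Slide.src≢stay s (trans e′ (sym e))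
    ... | inj₁ e | inj₂ e′ = neither (inj₁ (into q∈S s e e′))
    ... | inj₂ e | inj₁ e′ = neither (inj₂ (into q∈S s e e′))

-- Counting

𝟙 : ∀ {p} {P : Set p} → Dec P → ℕ
𝟙 (yes _) = 1
𝟙 (no _)  = 0

AtMostTwo : ∀ {a p} {A : Set a} → (A → Set p) → Set _
AtMostTwo P = ∀ {i j l} → i ≢ j → i ≢ l → j ≢ l → P i → P j → P l → ⊥

∑𝟙≡0 : ∀ {p k} {P : Fin k → Set p} (P? : ∀ i → Dec (P i)) → (∀ i → ¬ P i) → ∑[ i < k ] 𝟙 (P? i) ≡ 0
∑𝟙≡0 {k = k} P? none = trans (sum-cong-≗ zero-everywhere) (sum-replicate-zero k)
  where
  zero-everywhere : ∀ i → 𝟙 (P? i) ≡ 0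
  zero-everywhere i with P? i
  ... | yes Pi = ⊥-elim (none i Pi)
  ... | no _   = refl

∑𝟙≤1 : ∀ {p k} {P : Fin k → Set p} (P? : ∀ i → Dec (P i)) →
       (∀ {i j} → i ≢ j → P i → P j → ⊥) → ∑[ i < k ] 𝟙 (P? i) ≤ 1
∑𝟙≤1 {k = zero}  P? _      = z≤n
∑𝟙≤1 {k = suc k} P? unique with P? F.zero
... | yes P0 = ℕP.≤-reflexive (cong suc (∑𝟙≡0 (P? ∘ F.suc) (λ i → unique FP.0≢1+n P0)))
... | no _   = ∑𝟙≤1 (P? ∘ F.suc) (λ i≢j → unique (i≢j ∘ FP.suc-injective))

∑𝟙≤2 : ∀ {p k} {P : Fin k → Set p} (P? : ∀ i → Dec (P i)) → AtMostTwo P → ∑[ i < k ] 𝟙 (P? i) ≤ 2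
∑𝟙≤2 {k = zero}  P? _   = z≤n
∑𝟙≤2 {k = suc k} P? ≤two with P? F.zero
... | yes P0 = s≤s (∑𝟙≤1 (P? ∘ F.suc) (λ i≢j → ≤two FP.0≢1+n FP.0≢1+n (i≢j ∘ FP.suc-injective) P0))
... | no _   = ∑𝟙≤2 (P? ∘ F.suc) (λ i≢j i≢l j≢l →
                 ≤two (i≢j ∘ FP.suc-injective) (i≢l ∘ FP.suc-injective) (j≢l ∘ FP.suc-injective))

∑𝟙≡1 : ∀ {p k} {P : Fin k → Set p} (P? : ∀ i → Dec (P i)) {j} → P j → (∀ {i} → P i → i ≡ j) →
       ∑[ i < k ] 𝟙 (P? i) ≡ 1
∑𝟙≡1 {k = suc k} P? {F.zero} P0 only with P? F.zero
... | yes _  = cong suc (∑𝟙≡0 (P? ∘ F.suc) (λ i → FP.0≢1+n ∘ sym ∘ only))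
... | no ¬P0 = ⊥-elim (¬P0 P0)
∑𝟙≡1 {k = suc k} P? {F.suc j} Pj only with P? F.zero
... | yes P0 = ⊥-elim (FP.0≢1+n (only P0))
... | no _   = ∑𝟙≡1 (P? ∘ F.suc) Pj (FP.suc-injective ∘ only)

∑1≡ : ∀ k → ∑[ i < k ] 1 ≡ k
∑1≡ zero    = refl
∑1≡ (suc k) = cong suc (∑1≡ k)

∑-plus-zeros : ∀ {k} (d : Fin k → ℕ) → (∀ i → d i ≤ 1) →
               ∑[ i < k ] d i + ∑[ i < k ] 𝟙 (d i ℕP.≟ 0) ≡ k
∑-plus-zeros {k} d d≤1 = begin
  ∑[ i < k ] d i + ∑[ i < k ] 𝟙 (d i ℕP.≟ 0) ≡⟨ ∑-distrib-+ d (λ i → 𝟙 (d i ℕP.≟ 0)) ⟨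
  ∑[ i < k ] (d i + 𝟙 (d i ℕP.≟ 0))          ≡⟨ sum-cong-≗ (λ i → bit (d≤1 i)) ⟩
  ∑[ i < k ] 1                              ≡⟨ ∑1≡ k ⟩
  k                                         ∎
  where
  open ≡-Reasoning
  bit : ∀ {b} → b ≤ 1 → b + 𝟙 (b ℕP.≟ 0) ≡ 1
  bit z≤n       = refl
  bit (s≤s z≤n) = refl

odd∧≤2⇒1 : ∀ c U → U ≤ 2 → (2 * c + U) % 2 ≡ 1 → U ≡ 1
odd∧≤2⇒1 c U U≤2 odd = gap U U≤2 (trans (sym (U%2 c U)) odd)
  where
  U%2 : ∀ c U → (2 * c + U) % 2 ≡ U % 2
  U%2 c U rewrite ℕP.+-comm (2 * c) U | ℕP.*-comm 2 c = DivMod.[m+kn]%n≡m%n U c 2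
  gap : ∀ U → U ≤ 2 → U % 2 ≡ 1 → U ≡ 1
  gap 1 _ _ = refl
  gap 0 _ ()
  gap 2 _ ()
  gap (suc (suc (suc _))) (s≤s (s≤s ())) _

one-gap : ∀ {k} (d : Fin k → ℕ) → (∀ i → d i ≤ 1) → AtMostTwo (λ i → d i ≡ 0) →
          ∀ c → ∑[ i < k ] d i ≡ 2 * c → k % 2 ≡ 1 → 2 * c + 1 ≡ k
one-gap {k} d d≤1 ≤two-gaps c ∑d≡2c k-odd = subst (λ U → 2 * c + U ≡ k) U≡1 2c+U≡k
  where
  U = ∑[ i < k ] 𝟙 (d i ℕP.≟ 0)
  2c+U≡k : 2 * c + U ≡ k
  2c+U≡k = trans (cong (_+ U) (sym ∑d≡2c)) (∑-plus-zeros d d≤1)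
  U≡1 : U ≡ 1
  U≡1 = odd∧≤2⇒1 c U (∑𝟙≤2 (λ i → d i ℕP.≟ 0) ≤two-gaps) (subst (λ k → k % 2 ≡ 1) (sym 2c+U≡k) k-odd)

module _ {a} {A : Set a} where

  length-filter-∷ : ∀ {p} {P : A → Set p} (P? : Decidable P) x xs →
                    length (filter P? (x ∷ xs)) ≡ 𝟙 (P? x) + length (filter P? xs)
  length-filter-∷ P? x xs with P? x
  ... | yes _ = refl
  ... | no _  = refl

  ∑-length-filter : ∀ {k c} {R : Fin k → A → Set} (R? : ∀ i → Decidable (R i)) (L : List A) →
                    All (λ x → ∑[ i < k ] 𝟙 (R? i x) ≡ c) L →
                    ∑[ i < k ] length (filter (R? i) L) ≡ length L * c
  ∑-length-filter {k} R? [] [] = sum-replicate-zero k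
  ∑-length-filter {k} {c} R? (x ∷ L) (∑x≡c ∷ ∑L≡c) = begin
    ∑[ i < k ] length (filter (R? i) (x ∷ L))                      ≡⟨ sum-cong-≗ (λ i → length-filter-∷ (R? i) x L) ⟩
    ∑[ i < k ] (𝟙 (R? i x) + length (filter (R? i) L))             ≡⟨ ∑-distrib-+ (λ i → 𝟙 (R? i x)) _ ⟩
    ∑[ i < k ] 𝟙 (R? i x) + ∑[ i < k ] length (filter (R? i) L)    ≡⟨ cong₂ _+_ ∑x≡c (∑-length-filter R? L ∑L≡c) ⟩
    c + length L * c                                               ∎
    where open ≡-Reasoning

  ∈⇒length≢0 : ∀ {x : A} {xs} → x ∈ xs → length xs ≢ 0
  ∈⇒length≢0 (here _)  ()
  ∈⇒length≢0 (there _) ()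

  length≤1 : ∀ {xs : List A} → Unique xs → (∀ {x y} → x ∈ xs → y ∈ xs → x ≡ y) → length xs ≤ 1
  length≤1 {[]}        _                     _    = z≤n
  length≤1 {_ ∷ []}    _                     _    = s≤s z≤n
  length≤1 {_ ∷ _ ∷ _} ((x≢y ∷ _) ∷ _) same = ⊥-elim (x≢y (same (here refl) (there (here refl))))

¬¬-∀-Fin : ∀ {p} k {P : Fin k → Set p} → (∀ i → ¬ ¬ P i) → ¬ ¬ (∀ i → P i)
¬¬-∀-Fin zero    _     no-∀ = no-∀ λ ()
¬¬-∀-Fin (suc k) ¬¬P no-∀ = ¬¬P F.zero λ P0 → ¬¬-∀-Fin k (¬¬P ∘ F.suc) λ P+ →
  no-∀ λ { F.zero → P0 ; (F.suc i) → P+ i }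

tournament-free⇒AtMostTwo :
  ∀ {a p ℓ} {A : Set a} {P : A → Set p} (C : A → A → Set ℓ) →
  (∀ {x y} → x ≢ y → P x → P y → ¬ ¬ (C x y ⊎ C y x)) →
  (∀ {x y z} → x ≢ y → x ≢ z → y ≢ z → C x y → C x z → C y z → ⊥) →
  (∀ {x y z} → x ≢ y → x ≢ z → y ≢ z → C x y → C y z → C z x → ⊥) →
  AtMostTwo P
tournament-free⇒AtMostTwo C comparable transitive cyclic {x} {y} {z} x≢y x≢z y≢z Px Py Pz =
  comparable x≢y Px Py λ xy → comparable x≢z Px Pz λ xz → comparable y≢z Py Pz λ yz → triangle xy xz yz
  where
  y≢x = x≢y ∘ sym ; z≢x = x≢z ∘ sym ; z≢y = y≢z ∘ sym
  triangle : C x y ⊎ C y x → C x z ⊎ C z x → C y z ⊎ C z y → ⊥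
  triangle (inj₁ xy) (inj₁ xz) (inj₁ yz) = transitive x≢y x≢z y≢z xy xz yz
  triangle (inj₁ xy) (inj₁ xz) (inj₂ zy) = transitive x≢z x≢y z≢y xz xy zy
  triangle (inj₁ xy) (inj₂ zx) (inj₁ yz) = cyclic x≢y x≢z y≢z xy yz zx
  triangle (inj₁ xy) (inj₂ zx) (inj₂ zy) = transitive z≢x z≢y x≢y zx zy xy
  triangle (inj₂ yx) (inj₁ xz) (inj₁ yz) = transitive y≢x y≢z x≢z yx yz xz
  triangle (inj₂ yx) (inj₁ xz) (inj₂ zy) = cyclic x≢z x≢y z≢y xz zy yx
  triangle (inj₂ yx) (inj₂ zx) (inj₁ yz) = transitive y≢z y≢x z≢x yz yx zx
  triangle (inj₂ yx) (inj₂ zx) (inj₂ zy) = transitive z≢y z≢x y≢x zy zx yx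

-- Two cliques joined by sparse cross edges

module TwoCliques (m n : ℕ) where

  data Colour : Set where
    X Y : Colour

  size : Colour → ℕ
  size X = m
  size Y = n

  vertex : (c : Colour) → Fin (size c) → Fin (m + n)
  vertex X i = i ↑ˡ n
  vertex Y j = m ↑ʳ j

  x⟨_⟩ : Fin m → Fin (m + n)
  x⟨_⟩ = vertex X

  y⟨_⟩ : Fin n → Fin (m + n)
  y⟨_⟩ = vertex Y

  colour : Fin (m + n) → Colour
  colour v = [ (λ _ → X) , (λ _ → Y) ]′ (splitAt m v)

  colour-vertex : ∀ c i → colour (vertex c i) ≡ c
  colour-vertex X i = cong [ _ , _ ]′ (FP.splitAt-↑ˡ m i n)
  colour-vertex Y j = cong [ _ , _ ]′ (FP.splitAt-↑ʳ m n j)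

  vertex-≢ : ∀ {c c′ i i′} → c ≢ c′ → vertex c i ≢ vertex c′ i′
  vertex-≢ {c} {c′} {i} {i′} c≢c′ e =
    c≢c′ (trans (sym (colour-vertex c i)) (trans (cong colour e) (colour-vertex c′ i′)))

  vertex-injective : ∀ c {i i′} → vertex c i ≡ vertex c i′ → i ≡ i′
  vertex-injective X = FP.↑ˡ-injective n _ _
  vertex-injective Y = FP.↑ʳ-injective m _ _

  data Side : Fin (m + n) → Set where
    at : ∀ c (i : Fin (size c)) → Side (vertex c i)

  side : ∀ v → Side v
  side v with splitAt m v in eq
  ... | inj₁ i = subst Side (FP.splitAt⁻¹-↑ˡ eq) (at X i)
  ... | inj₂ j = subst Side (FP.splitAt⁻¹-↑ʳ eq) (at Y j)

  _≟ᶜ_ : (c c′ : Colour) → Dec (c ≡ c′)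
  X ≟ᶜ X = yes refl
  X ≟ᶜ Y = no λ ()
  Y ≟ᶜ X = no λ ()
  Y ≟ᶜ Y = yes refl

  data Kind : Set where
    XX XY YY : Kind

  kindOf : Colour → Colour → Kind
  kindOf X X = XX
  kindOf X Y = XY
  kindOf Y X = XY
  kindOf Y Y = YY

  kindOf-comm : ∀ c c′ → kindOf c c′ ≡ kindOf c′ c
  kindOf-comm X X = refl
  kindOf-comm X Y = refl
  kindOf-comm Y X = refl
  kindOf-comm Y Y = refl

  kindOf-cancelˡ : ∀ c {c₁ c₂} → kindOf c c₁ ≡ kindOf c c₂ → c₁ ≡ c₂
  kindOf-cancelˡ X {X} {X} _ = refl
  kindOf-cancelˡ X {Y} {Y} _ = refl
  kindOf-cancelˡ Y {X} {X} _ = refl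
  kindOf-cancelˡ Y {Y} {Y} _ = refl
  kindOf-cancelˡ X {X} {Y} ()
  kindOf-cancelˡ X {Y} {X} ()
  kindOf-cancelˡ Y {X} {Y} ()
  kindOf-cancelˡ Y {Y} {X} ()

  kindOf-≢ : ∀ {c c′} → c ≢ c′ → kindOf c c′ ≡ XY
  kindOf-≢ {X} {X} c≢c′ = ⊥-elim (c≢c′ refl)
  kindOf-≢ {X} {Y} _    = refl
  kindOf-≢ {Y} {X} _    = refl
  kindOf-≢ {Y} {Y} c≢c′ = ⊥-elim (c≢c′ refl)

  _≟ᴷ_ : (K K′ : Kind) → Dec (K ≡ K′)
  XX ≟ᴷ XX = yes refl
  XX ≟ᴷ XY = no λ ()
  XX ≟ᴷ YY = no λ ()
  XY ≟ᴷ XX = no λ ()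
  XY ≟ᴷ XY = yes refl
  XY ≟ᴷ YY = no λ ()
  YY ≟ᴷ XX = no λ ()
  YY ≟ᴷ XY = no λ ()
  YY ≟ᴷ YY = yes refl

  multiplicity : Colour → Kind → ℕ
  multiplicity X XX = 2
  multiplicity X XY = 1
  multiplicity X YY = 0
  multiplicity Y XX = 0
  multiplicity Y XY = 1
  multiplicity Y YY = 2

  multiplicity-kindOf : ∀ c c₁ c₂ → multiplicity c (kindOf c₁ c₂) ≡ 𝟙 (c₁ ≟ᶜ c) + 𝟙 (c₂ ≟ᶜ c)
  multiplicity-kindOf X X X = refl
  multiplicity-kindOf X X Y = refl
  multiplicity-kindOf X Y X = refl
  multiplicity-kindOf X Y Y = refl
  multiplicity-kindOf Y X X = refl
  multiplicity-kindOf Y X Y = refl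
  multiplicity-kindOf Y Y X = refl
  multiplicity-kindOf Y Y Y = refl

  kind : TwoSet (m + n) → Kind
  kind q = kindOf (colour (fst q)) (colour (snd q))

  kind-by-members : ∀ {u v q} → u ∈₂ q → v ∈₂ q → u ≢ v → kind q ≡ kindOf (colour u) (colour v)
  kind-by-members         (inj₁ refl) (inj₂ refl) _   = refl
  kind-by-members {q = q} (inj₂ refl) (inj₁ refl) _   = kindOf-comm (colour (fst q)) (colour (snd q))
  kind-by-members         (inj₁ refl) (inj₁ refl) u≢v = ⊥-elim (u≢v refl)
  kind-by-members         (inj₂ refl) (inj₂ refl) u≢v = ⊥-elim (u≢v refl)

  ∑-vertex-≟ : ∀ c v → ∑[ i < size c ] 𝟙 (vertex c i ≟ v) ≡ 𝟙 (colour v ≟ᶜ c)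
  ∑-vertex-≟ c v with side v
  ... | at c′ i′ rewrite colour-vertex c′ i′ with c′ ≟ᶜ c
  ...   | yes refl = ∑𝟙≡1 (λ i → vertex c i ≟ vertex c i′) refl (vertex-injective c)
  ...   | no c′≢c  = ∑𝟙≡0 (λ i → vertex c i ≟ vertex c′ i′) (λ i → vertex-≢ (c′≢c ∘ sym))

  ∑-vertex-∈₂ : ∀ c q → ∑[ i < size c ] 𝟙 (vertex c i ∈₂? q) ≡ multiplicity c (kind q)
  ∑-vertex-∈₂ c q@((a , b) , _) = begin
    ∑[ i < size c ] 𝟙 (vertex c i ∈₂? q)                          ≡⟨ sum-cong-≗ (λ i → 𝟙-∈₂ (vertex c i)) ⟩
    ∑[ i < size c ] (𝟙 (vertex c i ≟ a) + 𝟙 (vertex c i ≟ b))     ≡⟨ ∑-distrib-+ (λ i → 𝟙 (vertex c i ≟ a)) _ ⟩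
    ∑[ i < size c ] 𝟙 (vertex c i ≟ a) + ∑[ i < size c ] 𝟙 (vertex c i ≟ b)
                                                     ≡⟨ cong₂ _+_ (∑-vertex-≟ c a) (∑-vertex-≟ c b) ⟩
    𝟙 (colour a ≟ᶜ c) + 𝟙 (colour b ≟ᶜ c)                          ≡⟨ multiplicity-kindOf c (colour a) (colour b) ⟨
    multiplicity c (kind q)                                        ∎
    where
    open ≡-Reasoning
    𝟙-∈₂ : ∀ w → 𝟙 (w ∈₂? q) ≡ 𝟙 (w ≟ a) + 𝟙 (w ≟ b)
    𝟙-∈₂ w with w ≟ a | w ≟ b
    ... | yes refl | yes refl = ⊥-elim (fst≢snd q refl)
    ... | yes _    | no _     = refl
    ... | no _     | yes _    = refl
    ... | no _     | no _     = refl

  _∣_ : List (TwoSet (m + n)) → Kind → List (TwoSet (m + n))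
  L ∣ K = filter (λ q → kind q ≟ᴷ K) L

  length-by-kind : ∀ L → length L ≡ length (L ∣ XX) + length (L ∣ XY) + length (L ∣ YY)
  length-by-kind []      = refl
  length-by-kind (q ∷ L) with kind q
  ... | XX = cong suc (length-by-kind L)
  ... | XY = trans (cong suc (length-by-kind L))
                   (cong (_+ length (L ∣ YY)) (sym (ℕP.+-suc (length (L ∣ XX)) (length (L ∣ XY)))))
  ... | YY = trans (cong suc (length-by-kind L)) (sym (ℕP.+-suc _ (length (L ∣ YY))))

  record IsTwoCliqueGraph (G : Graph (m + n)) : Set where
    field
      adj-irrefl : ∀ {u} → ¬ Adj G u u
      adj-sym    : ∀ {u v} → Adj G u v → Adj G v u
      clique     : ∀ c {i i′} → i ≢ i′ → Adj G (vertex c i) (vertex c i′)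

  record SparseCross (k : ℕ) (G : Graph (m + n)) : Set where
    field
      unique-X-neighbour : ∀ {i i′ j} → Adj G x⟨ i ⟩ y⟨ j ⟩ → Adj G x⟨ i′ ⟩ y⟨ j ⟩ → i ≡ i′
      two-attached       : AtMostTwo (λ i → ∃[ j ] Adj G x⟨ i ⟩ y⟨ j ⟩)
      attached-below     : ∀ {i j} → Adj G x⟨ i ⟩ y⟨ j ⟩ → toℕ j < k

  module WellCoveredness {G : Graph (m + n)} (two-cliques : IsTwoCliqueGraph G)
                         {k : ℕ} (sparse : SparseCross k G) where

    open IsTwoCliqueGraph two-cliques
    open SparseCross sparse
    open TokenGraph G adj-irrefl adj-sym

    adj-if-same-colour : ∀ {u v} → colour u ≡ colour v → u ≢ v → Adj G u v
    adj-if-same-colour {u} {v} with side u | side v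
    ... | at c i | at c′ i′ rewrite colour-vertex c i | colour-vertex c′ i′ =
      λ { refl u≢v → clique c (u≢v ∘ cong (vertex c)) }

    module Maximal (S : List (TwoSet (m + n))) (mis : MaximalIndependent (T₂Adj G) S) where

      pairs-disjoint : ∀ {p q w} → p ∈ S → q ∈ S → kind p ≡ kind q → w ∈₂ p → w ∈₂ q → p ≡ q
      pairs-disjoint {p} {q} {w} p∈S q∈S same-kind w∈p w∈q with other p w∈p ≟ other q w∈q
      ... | yes a≡b = ≡-by-members (other-≢ w∈p ∘ sym) w∈p (other-∈₂ w∈p) w∈q
                        (subst (_∈₂ q) (sym a≡b) (other-∈₂ w∈q))
      ... | no a≢b  = ⊥-elim (proj₁ (proj₂ mis) p∈S q∈S (slide⇒T₂Adj {A = p} {B = q} record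
        { stay = w ; src = a ; dst = b ; stay∈A = w∈p ; stay∈B = w∈q
        ; src∈A = other-∈₂ w∈p ; src≢stay = other-≢ w∈p ; dst∈B = other-∈₂ w∈q
        ; dst∉A = [ other-≢ w∈q , a≢b ∘ sym ]′ ∘ ∈₂-cases p w∈p (other-∈₂ w∈p) (other-≢ w∈p ∘ sym)
        ; edge = adj-if-same-colour same-colour a≢b }))
        where
        a = other p w∈p
        b = other q w∈q
        same-colour : colour a ≡ colour b
        same-colour = kindOf-cancelˡ (colour w)
          (trans (sym (kind-by-members {q = p} w∈p (other-∈₂ w∈p) (other-≢ w∈p ∘ sym)))
          (trans same-kind (kind-by-members {q = q} w∈q (other-∈₂ w∈q) (other-≢ w∈q ∘ sym))))

      record Partner (K : Kind) (w z : Fin (m + n)) : Set where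
        field
          pairing   : TwoSet (m + n)
          pairing∈S : pairing ∈ S
          kind≡     : kind pairing ≡ K
          w∈        : w ∈₂ pairing
          z∈        : z ∈₂ pairing
          z≢w       : z ≢ w

      Covered : Kind → Fin (m + n) → Set
      Covered K w = ∃[ z ] Partner K w z

      partner-sym : ∀ {K w z} → Partner K w z → Partner K z w
      partner-sym p = record
        { pairing = pairing ; pairing∈S = pairing∈S ; kind≡ = kind≡ ; w∈ = z∈ ; z∈ = w∈ ; z≢w = z≢w ∘ sym }
        where open Partner p

      partner-unique : ∀ {K w z z′} → Partner K w z → Partner K w z′ → z ≡ z′
      partner-unique p p′ with pairs-disjoint (Partner.pairing∈S p) (Partner.pairing∈S p′)
                                 (trans (Partner.kind≡ p) (sym (Partner.kind≡ p′))) (Partner.w∈ p) (Partner.w∈ p′)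
      ... | refl with ∈₂-cases (Partner.pairing p) (Partner.w∈ p) (Partner.z∈ p) (Partner.z≢w p ∘ sym) (Partner.z∈ p′)
      ...   | inj₁ z′≡w = ⊥-elim (Partner.z≢w p′ z′≡w)
      ...   | inj₂ z′≡z = sym z′≡z

      partner-injective : ∀ {K w w′ z} → Partner K w z → Partner K w′ z → w ≡ w′
      partner-injective p p′ = partner-unique (partner-sym p) (partner-sym p′)

      partner-kind : ∀ {K w z} → Partner K w z → kindOf (colour w) (colour z) ≡ K
      partner-kind {w = w} p =
        trans (sym (kind-by-members {q = pairing} w∈ z∈ (z≢w ∘ sym))) kind≡
        where open Partner p

      slide-partner : ∀ {a b} (s : SlidesInto S a b) → let z = SlidesInto.moved s in
                      Partner (kindOf (colour a) (colour z)) a z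
      slide-partner s = record
        { pairing = target ; pairing∈S = target∈S
        ; kind≡ = kind-by-members {q = target} a∈target moved∈target (moved≢a ∘ sym)
        ; w∈ = a∈target ; z∈ = moved∈target ; z≢w = moved≢a }
        where open SlidesInto s

      pair-partner : ∀ {a b} (a≢b : a ≢ b) → pair a b a≢b ∈ S → Partner (kindOf (colour a) (colour b)) a b
      pair-partner {a} {b} a≢b P∈S = record
        { pairing = pair a b a≢b ; pairing∈S = P∈S
        ; kind≡ = kind-by-members {q = pair a b a≢b} (∈-pairˡ a≢b) (∈-pairʳ a≢b) a≢b
        ; w∈ = ∈-pairˡ a≢b ; z∈ = ∈-pairʳ a≢b ; z≢w = a≢b ∘ sym }

      partner-at : ∀ {c c′ i i′} → let v = vertex c i ; v′ = vertex c′ i′ in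
                   Partner (kindOf (colour v) (colour v′)) v v′ → Partner (kindOf c c′) v v′
      partner-at {c} {c′} {i} {i′} =
        subst (λ K → Partner K _ _) (cong₂ kindOf (colour-vertex c i) (colour-vertex c′ i′))

      Attached : Fin (m + n) → Fin (m + n) → Set
      Attached a b = ∃[ z ] Partner XY a z × Adj G b z

      uncovered-attached : ∀ {c a b} → colour a ≡ c → colour b ≡ c → a ≢ b →
                           ¬ Covered (kindOf c c) a → ¬ Covered (kindOf c c) b → ¬ ¬ (Attached a b ⊎ Attached b a)
      uncovered-attached {c} {a} {b} a∈c b∈c a≢b a-free b-free =
        ¬¬-map (Sum.map (attach a∈c a-free) (attach b∈c b-free)) (slides-into mis a≢b P∉S)
        where
        P∉S : pair a b a≢b ∉ S
        P∉S = a-free ∘ (b ,_) ∘ subst (λ K → Partner K a b) (cong₂ kindOf a∈c b∈c) ∘ pair-partner a≢b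
        attach : ∀ {a b} → colour a ≡ c → ¬ Covered (kindOf c c) a → SlidesInto S a b → Attached a b
        attach {a} a∈c free s with colour (SlidesInto.moved s) ≟ᶜ colour a
        ... | yes same   = ⊥-elim (free (_ , subst (λ K → Partner K a _)
                             (trans (cong (kindOf (colour a)) same) (cong₂ kindOf a∈c a∈c)) (slide-partner s)))
        ... | no differs = _ , subst (λ K → Partner K a _) (kindOf-≢ (differs ∘ sym)) (slide-partner s)
                             , SlidesInto.edge s

      x-partner-in-Y : ∀ {i z} → Partner XY x⟨ i ⟩ z → ∃[ j ] z ≡ y⟨ j ⟩
      x-partner-in-Y {i} {z} p with side z
      ... | at Y j  = j , refl
      ... | at X i′ with trans (sym (cong₂ kindOf (colour-vertex X i) (colour-vertex X i′))) (partner-kind p)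
      ...   | ()

      y-partner-in-X : ∀ {j z} → Partner XY y⟨ j ⟩ z → ∃[ i ] z ≡ x⟨ i ⟩
      y-partner-in-X {j} {z} p with side z
      ... | at X i  = i , refl
      ... | at Y j′ with trans (sym (cong₂ kindOf (colour-vertex Y j) (colour-vertex Y j′))) (partner-kind p)
      ...   | ()

      uncovered-X : AtMostTwo (λ i → ¬ Covered XX x⟨ i ⟩)
      uncovered-X = tournament-free⇒AtMostTwo (λ i i′ → Attached x⟨ i ⟩ x⟨ i′ ⟩)
        (λ i≢i′ → uncovered-attached (colour-vertex X _) (colour-vertex X _) (i≢i′ ∘ vertex-injective X))
        transitive cyclic
        where
        transitive : ∀ {i i′ i″} → i ≢ i′ → i ≢ i″ → i′ ≢ i″ → Attached x⟨ i ⟩ x⟨ i′ ⟩ →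
                     Attached x⟨ i ⟩ x⟨ i″ ⟩ → Attached x⟨ i′ ⟩ x⟨ i″ ⟩ → ⊥
        transitive _ _ i′≢i″ (_ , p , adj) (_ , p′ , adj′) _ with partner-unique p p′
        ... | refl with x-partner-in-Y p
        ...   | _ , refl = i′≢i″ (unique-X-neighbour adj adj′)
        cyclic : ∀ {i i′ i″} → i ≢ i′ → i ≢ i″ → i′ ≢ i″ → Attached x⟨ i ⟩ x⟨ i′ ⟩ →
                 Attached x⟨ i′ ⟩ x⟨ i″ ⟩ → Attached x⟨ i″ ⟩ x⟨ i ⟩ → ⊥
        cyclic i≢i′ i≢i″ i′≢i″ (_ , p , adj) (_ , p′ , adj′) (_ , p″ , adj″)
          with x-partner-in-Y p | x-partner-in-Y p′ | x-partner-in-Y p″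
        ... | j , refl | j′ , refl | j″ , refl =
          two-attached i≢i′ i≢i″ i′≢i″ (j″ , adj″) (j , adj) (j′ , adj′)

      uncovered-Y : AtMostTwo (λ j → ¬ Covered YY y⟨ j ⟩)
      uncovered-Y = tournament-free⇒AtMostTwo (λ j j′ → Attached y⟨ j ⟩ y⟨ j′ ⟩)
        (λ j≢j′ → uncovered-attached (colour-vertex Y _) (colour-vertex Y _) (j≢j′ ∘ vertex-injective Y))
        transitive cyclic
        where
        partners-distinct : ∀ {j j′ i i′} → j ≢ j′ → Partner XY y⟨ j ⟩ x⟨ i ⟩ → Partner XY y⟨ j′ ⟩ x⟨ i′ ⟩ → i ≢ i′
        partners-distinct j≢j′ p p′ refl = j≢j′ (vertex-injective Y (partner-injective p p′))
        transitive : ∀ {j j′ j″} → j ≢ j′ → j ≢ j″ → j′ ≢ j″ → Attached y⟨ j ⟩ y⟨ j′ ⟩ →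
                     Attached y⟨ j ⟩ y⟨ j″ ⟩ → Attached y⟨ j′ ⟩ y⟨ j″ ⟩ → ⊥
        transitive j≢j′ _ _ _ (_ , p , adj) (_ , p′ , adj′) with y-partner-in-X p | y-partner-in-X p′
        ... | _ , refl | _ , refl = partners-distinct j≢j′ p p′ (unique-X-neighbour (adj-sym adj) (adj-sym adj′))
        cyclic : ∀ {j j′ j″} → j ≢ j′ → j ≢ j″ → j′ ≢ j″ → Attached y⟨ j ⟩ y⟨ j′ ⟩ →
                 Attached y⟨ j′ ⟩ y⟨ j″ ⟩ → Attached y⟨ j″ ⟩ y⟨ j ⟩ → ⊥
        cyclic {j} {j′} {j″} j≢j′ j≢j″ j′≢j″ (_ , p , adj) (_ , p′ , adj′) (_ , p″ , adj″)
          with y-partner-in-X p | y-partner-in-X p′ | y-partner-in-X p″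
        ... | _ , refl | _ , refl | _ , refl =
          two-attached (partners-distinct j≢j′ p p′) (partners-distinct j≢j″ p p″) (partners-distinct j′≢j″ p′ p″)
                       (j′ , adj-sym adj) (j″ , adj-sym adj′) (j , adj-sym adj″)

      count : Kind → ℕ
      count K = length (S ∣ K)

      deg : Kind → Fin (m + n) → ℕ
      deg K w = length (filter (w ∈₂?_) (S ∣ K))

      deg≤1 : ∀ K w → deg K w ≤ 1
      deg≤1 K w = length≤1 (Unique.filter⁺ (w ∈₂?_) (Unique.filter⁺ (λ q → kind q ≟ᴷ K) (proj₁ mis))) same
        where
        same : ∀ {p q} → p ∈ filter (w ∈₂?_) (S ∣ K) → q ∈ filter (w ∈₂?_) (S ∣ K) → p ≡ q
        same p∈ q∈ with ∈-filter⁻ (w ∈₂?_) p∈ | ∈-filter⁻ (w ∈₂?_) q∈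
        ... | p∈S∣K , w∈p | q∈S∣K , w∈q with ∈-filter⁻ (λ q → kind q ≟ᴷ K) p∈S∣K | ∈-filter⁻ (λ q → kind q ≟ᴷ K) q∈S∣K
        ...   | p∈S , p-kind | q∈S , q-kind = pairs-disjoint p∈S q∈S (trans p-kind (sym q-kind)) w∈p w∈q

      deg≡0⇒uncovered : ∀ {K w} → deg K w ≡ 0 → ¬ Covered K w
      deg≡0⇒uncovered {K} {w} deg≡0 (_ , p) =
        ∈⇒length≢0 (∈-filter⁺ (w ∈₂?_) (∈-filter⁺ (λ q → kind q ≟ᴷ K) pairing∈S kind≡) w∈) deg≡0
        where open Partner p

      ∑-deg : ∀ c K → ∑[ i < size c ] deg K (vertex c i) ≡ count K * multiplicity c K
      ∑-deg c K = ∑-length-filter (λ i → vertex c i ∈₂?_) (S ∣ K)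
        (All.map (λ {q} kind≡K → trans (∑-vertex-∈₂ c q) (cong (multiplicity c) kind≡K))
                 (all-filter (λ q → kind q ≟ᴷ K) S))

      count-monochromatic : ∀ c → AtMostTwo (λ i → ¬ Covered (kindOf c c) (vertex c i)) → size c % 2 ≡ 1 →
                            2 * count (kindOf c c) + 1 ≡ size c
      count-monochromatic c ≤two-free odd =
        one-gap (λ i → deg (kindOf c c) (vertex c i)) (λ i → deg≤1 _ _)
          (λ i≢j i≢l j≢l d₁ d₂ d₃ →
             ≤two-free i≢j i≢l j≢l (deg≡0⇒uncovered d₁) (deg≡0⇒uncovered d₂) (deg≡0⇒uncovered d₃))
          (count (kindOf c c)) (trans (∑-deg c (kindOf c c)) (twice c)) odd
        where
        twice : ∀ c → count (kindOf c c) * multiplicity c (kindOf c c) ≡ 2 * count (kindOf c c)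
        twice X = ℕP.*-comm (count XX) 2
        twice Y = ℕP.*-comm (count YY) 2

      -- The ways a 2-set of S can be one slide away from {x⟨ i ⟩, y⟨ j ⟩} when x⟨ i ⟩ has no XY-partner.
      data Blocker (i : Fin m) (j : Fin n) : Set where
        x-partner  : ∀ {i′} → Partner XY y⟨ j ⟩ x⟨ i′ ⟩ → i′ ≢ i → Blocker i j
        y-partner  : ∀ {j′} → Partner YY y⟨ j ⟩ y⟨ j′ ⟩ → Adj G x⟨ i ⟩ y⟨ j′ ⟩ → Blocker i j
        xx-partner : ∀ {i′} → Partner XX x⟨ i ⟩ x⟨ i′ ⟩ → Adj G x⟨ i′ ⟩ y⟨ j ⟩ → Blocker i j

      blocked : ∀ {i} → ¬ Covered XY x⟨ i ⟩ → ∀ j → ¬ ¬ Blocker i j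
      blocked {i} free j = ¬¬-map [ x-stays , y-stays ]′ (slides-into mis x≢y P∉S)
        where
        x≢y : x⟨ i ⟩ ≢ y⟨ j ⟩
        x≢y = vertex-≢ {X} {Y} λ ()
        P∉S : pair x⟨ i ⟩ y⟨ j ⟩ x≢y ∉ S
        P∉S = free ∘ (y⟨ j ⟩ ,_) ∘ partner-at {X} {Y} ∘ pair-partner x≢y
        x-stays-at : ∀ {z} → Side z → Partner (kindOf (colour x⟨ i ⟩) (colour z)) x⟨ i ⟩ z →
                     Adj G y⟨ j ⟩ z → Blocker i j
        x-stays-at (at X i′) p adj = xx-partner (partner-at {X} {X} p) (adj-sym adj)
        x-stays-at (at Y j′) p _   = ⊥-elim (free (_ , partner-at {X} {Y} p))
        y-stays-at : ∀ {z} → Side z → Partner (kindOf (colour y⟨ j ⟩) (colour z)) y⟨ j ⟩ z →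
                     Adj G x⟨ i ⟩ z → z ≢ x⟨ i ⟩ → Blocker i j
        y-stays-at (at X i′) p _   z≢x = x-partner (partner-at {Y} {X} p) (z≢x ∘ cong x⟨_⟩)
        y-stays-at (at Y j′) p adj _   = y-partner (partner-at {Y} {Y} p) adj
        x-stays : SlidesInto S x⟨ i ⟩ y⟨ j ⟩ → Blocker i j
        x-stays s = x-stays-at (side _) (slide-partner s) (SlidesInto.edge s)
        y-stays : SlidesInto S y⟨ j ⟩ x⟨ i ⟩ → Blocker i j
        y-stays s = y-stays-at (side _) (slide-partner s) (SlidesInto.edge s) (SlidesInto.moved≢b s)

      index : ∀ {i j} → Adj G x⟨ i ⟩ y⟨ j ⟩ → Fin k
      index adj = F.fromℕ< (attached-below adj)

      index-injective : ∀ {i i′ j j′} (adj : Adj G x⟨ i ⟩ y⟨ j ⟩) (adj′ : Adj G x⟨ i′ ⟩ y⟨ j′ ⟩) →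
                        index adj ≡ index adj′ → j ≡ j′
      index-injective adj adj′ =
        FP.toℕ-injective ∘ FP.fromℕ<-injective _ _ (attached-below adj) (attached-below adj′)

      code : ∀ {i j} → Blocker i j → Fin m ⊎ Fin k
      code (x-partner {i′} _ _) = inj₁ i′
      code (y-partner _ adj)    = inj₂ (index adj)
      code (xx-partner _ adj)   = inj₂ (index adj)

      code-≢ : ∀ {i j} (b : Blocker i j) → code b ≢ inj₁ i
      code-≢ (x-partner _ i′≢i) refl = i′≢i refl
      code-≢ (y-partner _ _)    ()
      code-≢ (xx-partner _ _)   ()

      code-injective : ∀ {i j j′} (b : Blocker i j) (b′ : Blocker i j′) → code b ≡ code b′ → j ≡ j′
      code-injective (x-partner p _) (x-partner p′ _) refl = vertex-injective Y (partner-injective p p′)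
      code-injective (y-partner p adj) (y-partner p′ adj′) e with index-injective adj adj′ (SumP.inj₂-injective e)
      ... | refl = vertex-injective Y (partner-injective p p′)
      code-injective (xx-partner _ adj) (xx-partner _ adj′) e = index-injective adj adj′ (SumP.inj₂-injective e)
      code-injective (y-partner _ adj) (xx-partner p′ adj′) e with index-injective adj adj′ (SumP.inj₂-injective e)
      ... | refl = ⊥-elim (Partner.z≢w p′ (cong x⟨_⟩ (unique-X-neighbour adj′ adj)))
      code-injective (xx-partner p adj) (y-partner _ adj′) e with index-injective adj adj′ (SumP.inj₂-injective e)
      ... | refl = ⊥-elim (Partner.z≢w p (cong x⟨_⟩ (unique-X-neighbour adj adj′)))
      code-injective (x-partner _ _)  (y-partner _ _)  ()
      code-injective (x-partner _ _)  (xx-partner _ _) ()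
      code-injective (y-partner _ _)  (x-partner _ _)  ()
      code-injective (xx-partner _ _) (x-partner _ _)  ()

      -- Pigeonhole: i and the codes of the n blockers are n + 1 distinct elements of Fin m ⊎ Fin k.
      ¬¬-covered-XY : m + k ≤ n → ∀ i → ¬ ¬ Covered XY x⟨ i ⟩
      ¬¬-covered-XY m+k≤n i free = ¬¬-∀-Fin n (blocked free) λ b →
        ℕP.<-irrefl refl (ℕP.≤-trans (FP.injective⇒≤ (tagged-injective b ∘ join-injective)) m+k≤n)
        where
        tagged : (∀ j → Blocker i j) → Fin (suc n) → Fin m ⊎ Fin k
        tagged b F.zero    = inj₁ i
        tagged b (F.suc j) = code (b j)
        tagged-injective : ∀ b {j j′} → tagged b j ≡ tagged b j′ → j ≡ j′
        tagged-injective b {F.zero}  {F.zero}   _ = refl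
        tagged-injective b {F.zero}  {F.suc j′} e = ⊥-elim (code-≢ (b j′) (sym e))
        tagged-injective b {F.suc j} {F.zero}   e = ⊥-elim (code-≢ (b j) e)
        tagged-injective b {F.suc j} {F.suc j′} e = cong F.suc (code-injective (b j) (b j′) e)
        join-injective : ∀ {a b} → join m k a ≡ join m k b → a ≡ b
        join-injective {a} {b} e =
          trans (sym (FP.splitAt-join m k a)) (trans (cong (splitAt m) e) (FP.splitAt-join m k b))

      count-XY : m + k ≤ n → count XY ≡ m
      count-XY m+k≤n = begin
        count XY                          ≡⟨ ℕP.*-identityʳ (count XY) ⟨
        count XY * 1                      ≡⟨ ∑-deg X XY ⟨
        ∑[ i < m ] deg XY x⟨ i ⟩          ≡⟨ sum-cong-≗ deg≡1 ⟩
        ∑[ i < m ] 1                      ≡⟨ ∑1≡ m ⟩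
        m                                 ∎
        where
        open ≡-Reasoning
        deg≡1 : ∀ i → deg XY x⟨ i ⟩ ≡ 1
        deg≡1 i with deg XY x⟨ i ⟩ | deg≤1 XY x⟨ i ⟩ | deg≡0⇒uncovered {XY} {x⟨ i ⟩}
        ... | 0           | _      | uncovered = ⊥-elim (¬¬-covered-XY m+k≤n i (uncovered refl))
        ... | 1           | _      | _         = refl
        ... | suc (suc _) | s≤s () | _

      count-XX : m % 2 ≡ 1 → 2 * count XX + 1 ≡ m
      count-XX = count-monochromatic X uncovered-X

      count-YY : n % 2 ≡ 1 → 2 * count YY + 1 ≡ n
      count-YY = count-monochromatic Y uncovered-Y

    well-covered : m + k ≤ n → m % 2 ≡ 1 → n % 2 ≡ 1 → WellCovered (T₂Adj G)
    well-covered m+k≤n m-odd n-odd S S′ mis mis′ = begin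
      length S                                               ≡⟨ length-by-kind S ⟩
      length (S ∣ XX) + length (S ∣ XY) + length (S ∣ YY)    ≡⟨ cong₂ _+_ (cong₂ _+_ same-XX same-XY) same-YY ⟩
      length (S′ ∣ XX) + length (S′ ∣ XY) + length (S′ ∣ YY) ≡⟨ length-by-kind S′ ⟨
      length S′                                              ∎
      where
      open ≡-Reasoning
      module M  = Maximal S mis
      module M′ = Maximal S′ mis′
      half-unique : ∀ {a b r} → 2 * a + 1 ≡ r → 2 * b + 1 ≡ r → a ≡ b
      half-unique e e′ = ℕP.*-cancelˡ-≡ _ _ 2 (ℕP.+-cancelʳ-≡ 1 _ _ (trans e (sym e′)))
      same-XX : M.count XX ≡ M′.count XX
      same-XX = half-unique (M.count-XX m-odd) (M′.count-XX m-odd)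
      same-XY : M.count XY ≡ M′.count XY
      same-XY = trans (M.count-XY m+k≤n) (sym (M′.count-XY m+k≤n))
      same-YY : M.count YY ≡ M′.count YY
      same-YY = half-unique (M.count-YY n-odd) (M′.count-YY n-odd)

-- The graphs of the theorem

module _ {s t m n : ℕ} {i : Fin m} {j : Fin n} where

  cross-below : Cross s t i j → toℕ j < s + t
  cross-below (inj₁ (_ , j<s))     = ℕP.≤-trans j<s (ℕP.m≤m+n s t)
  cross-below (inj₂ (_ , _ , j<s+t)) = j<s+t

  cross-source : Cross s t i j → toℕ i ≡ 0 ⊎ toℕ i ≡ 1
  cross-source (inj₁ (i≡0 , _)) = inj₁ i≡0
  cross-source (inj₂ (i≡1 , _)) = inj₂ i≡1

  cross-unique : ∀ {i′} → Cross s t i j → Cross s t i′ j → i ≡ i′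
  cross-unique (inj₁ (i≡0 , _))     (inj₁ (i′≡0 , _))     = FP.toℕ-injective (trans i≡0 (sym i′≡0))
  cross-unique (inj₂ (i≡1 , _))     (inj₂ (i′≡1 , _))     = FP.toℕ-injective (trans i≡1 (sym i′≡1))
  cross-unique (inj₁ (_ , j<s))     (inj₂ (_ , s≤j , _)) = ⊥-elim (ℕP.<⇒≱ j<s s≤j)
  cross-unique (inj₂ (_ , s≤j , _)) (inj₁ (_ , j<s))     = ⊥-elim (ℕP.<⇒≱ j<s s≤j)

at-most-two-below-2 : ∀ {m} → AtMostTwo (λ (i : Fin m) → toℕ i ≡ 0 ⊎ toℕ i ≡ 1)
at-most-two-below-2 i≢j i≢l j≢l = pigeon
  where
  same : ∀ {m} {i j : Fin m} {v} → toℕ i ≡ v → toℕ j ≡ v → i ≡ j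
  same i≡v j≡v = FP.toℕ-injective (trans i≡v (sym j≡v))
  pigeon : _ → _ → _ → ⊥
  pigeon (inj₁ i≡0) (inj₁ j≡0) _          = i≢j (same i≡0 j≡0)
  pigeon (inj₂ i≡1) (inj₂ j≡1) _          = i≢j (same i≡1 j≡1)
  pigeon (inj₁ i≡0) (inj₂ _)   (inj₁ l≡0) = i≢l (same i≡0 l≡0)
  pigeon (inj₂ i≡1) (inj₁ _)   (inj₂ l≡1) = i≢l (same i≡1 l≡1)
  pigeon (inj₁ _)   (inj₂ j≡1) (inj₂ l≡1) = j≢l (same j≡1 l≡1)
  pigeon (inj₂ _)   (inj₁ j≡0) (inj₁ l≡0) = j≢l (same j≡0 l≡0)

module _ (m n s t : ℕ) where
  open TwoCliques m n

  private
    G = Gmnst m n s t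

    adj-xy : ∀ i j → Adj G x⟨ i ⟩ y⟨ j ⟩ ≡ Cross s t i j
    adj-xy i j rewrite FP.splitAt-↑ˡ m i n | FP.splitAt-↑ʳ m n j = refl

    cross : ∀ {i j} → Adj G x⟨ i ⟩ y⟨ j ⟩ → Cross s t i j
    cross {i} {j} = subst (λ A → A) (adj-xy i j)

  Gmnst-two-cliques : IsTwoCliqueGraph G
  Gmnst-two-cliques = record { adj-irrefl = irrefl ; adj-sym = symmetric ; clique = clique }
    where
    irrefl : ∀ {u} → ¬ Adj G u u
    irrefl {u} with splitAt m u
    ... | inj₁ i = λ i≢i → i≢i refl
    ... | inj₂ j = λ j≢j → j≢j refl
    symmetric : ∀ {u v} → Adj G u v → Adj G v u
    symmetric {u} {v} with splitAt m u | splitAt m v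
    ... | inj₁ i | inj₁ i′ = _∘ sym
    ... | inj₂ j | inj₂ j′ = _∘ sym
    ... | inj₁ i | inj₂ j  = λ c → c
    ... | inj₂ j | inj₁ i  = λ c → c
    clique : ∀ c {i i′} → i ≢ i′ → Adj G (vertex c i) (vertex c i′)
    clique X {i} {i′} rewrite FP.splitAt-↑ˡ m i n | FP.splitAt-↑ˡ m i′ n = λ i≢i′ → i≢i′
    clique Y {j} {j′} rewrite FP.splitAt-↑ʳ m n j | FP.splitAt-↑ʳ m n j′ = λ j≢j′ → j≢j′

  Gmnst-sparse : SparseCross (s + t) G
  Gmnst-sparse = record
    { unique-X-neighbour = λ adj adj′ → cross-unique (cross adj) (cross adj′)
    ; two-attached = λ i≢j i≢l j≢l (_ , a) (_ , b) (_ , c) →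
        at-most-two-below-2 i≢j i≢l j≢l (cross-source (cross a)) (cross-source (cross b)) (cross-source (cross c))
    ; attached-below = cross-below ∘ cross }

theorem6p10 : (m n s t : ℕ) → m < n → m % 2 ≡ 1 → n % 2 ≡ 1 →
    s + t ≤ n ∸ m →
    WellCovered (T₂Adj (Gmnst m n s t))
theorem6p10 m n s t m<n m-odd n-odd s+t≤n∸m =
  TwoCliques.WellCoveredness.well-covered m n (Gmnst-two-cliques m n s t) (Gmnst-sparse m n s t)
    m+s+t≤n m-odd n-odd
  where
  m+s+t≤n : m + (s + t) ≤ n
  m+s+t≤n = subst (m + (s + t) ≤_) (ℕP.m+[n∸m]≡n (ℕP.<⇒≤ m<n)) (ℕP.+-monoʳ-≤ m s+t≤n∸m)
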